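{- Let $P$ be a program (negation in clause bodies allowed). If $M$ and $N$ are $\sqsupseteq^{\mathbf{4}}$-models of $P$, then $M\sqcap N$ is a $\sqsupseteq^{\mathbf{4}}$-model of $P$.
   Context: Programs: atoms are $p(t_1,\ldots,t_n)$ over a fixed first-order alphabet, with a distinguished binary equality predicate $=$. A literal is an atom $A$ or its negation $\neg A$; a conjunction is a conjunction of literals; a disjunction is $C_1\lor\cdots\lor C_k$ ($k>0$) with each $C_i$ a conjunction. A predicate definition is a pair $(H,\exists W[D])$ where $H=p(V_1,\ldots,V_n)$ with distinct variables $V_i$, $D$ is a disjunction, and $W=\mathrm{vars}(D)\setminus\mathrm{vars}(H)$. A program is a finite set of predicate definitions with pairwise distinct head predicate symbols. A head grounding of a definition is an instance in which only the head variables are replaced by terms, so that the head becomes ground. $\mathcal{G}$ is the set of ground atoms. Truth values $\mathbf{4}=\{\mathbf{u},\mathbf{f},\mathbf{t},\mathbf{i}\}$ with information order $\sqsubseteq$: $\mathbf{u}\sqsubseteq x\sqsubseteq\mathbf{i}$ for all $x$, $x\sqsubseteq x$, $\mathbf{f},\mathbf{t}$ incomparable. Interpretations: pairs $I=(T_I,F_I)$ of subsets of $\mathcal{G}$, where a ground equality atom $s=s'$ lies in $T_I$ (and not $F_I$) if $s,s'$ are identical and in $F_I$ (and not $T_I$) otherwise. $I$ makes a ground atom $A$ true iff $A\in T_I$, false iff $A\in F_I$; $\neg A$ true iff $A\in F_I$, false iff $A\in T_I$; a ground conjunction true iff all conjuncts true, false iff some conjunct false; a ground disjunction true iff some disjunct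 true, false iff all false; $\exists W[D]$ true iff some ground instance of $D$ is made true, false iff all ground instances are made false. $I(F)$ is $\mathbf{u}$ (neither), $\mathbf{f}$ (false only), $\mathbf{t}$ (true only), $\mathbf{i}$ (both). The meet of interpretations is $M\sqcap N=(T_M\cap T_N,F_M\cap F_N)$. $I$ is a $\sqsupseteq^{\mathbf{4}}$-model of $P$ if $I(H)\sqsupseteq I(B)$ for every head grounding $(H,B)$ of every definition of $P$. -}

module Defs where

open import Data.Nat using (ℕ)
open import Data.Vec using (Vec; []; _∷_; toList)
open import Data.List using (List; []; _∷_; map)
open import Data.List.NonEmpty using (List⁺) renaming (toList to toList⁺)
open import Data.List.Relation.Unary.All using (All)
open import Data.List.Relation.Unary.Any using (Any)
open import Data.List.Relation.Unary.AllPairs using (AllPairs)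
open import Data.List.Relation.Unary.Unique.Propositional using (Unique)
open import Data.List.Membership.Propositional using (_∈_)
open import Data.Product using (Σ; _×_; ∃)
open import Relation.Binary.PropositionalEquality using (_≡_; _≢_)
open import Relation.Nullary using (¬_)

-- Equality is a distinguished binary predicate, given as a separate
-- atom constructor.
record Signature : Set₁ where
  field
    Fun    : Set
    farity : Fun → ℕ
    PSym   : Set
    parity : PSym → ℕ

module Lang (S : Signature) where
  open Signature S

  Var : Set
  Var = ℕ

  data Term : Set where
    var : Var → Term
    fn  : (f : Fun) → Vec Term (farity f) → Term

  data GTerm : Set where
    gfn : (f : Fun) → Vec GTerm (farity f) → GTerm

  data Atom : Set where
    atom : (p : PSym) → Vec Term (parity p) → Atom
    _≐_  : Term → Term → Atom

  data GAtom : Set where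
    gatom : (p : PSym) → Vec GTerm (parity p) → GAtom
    _≐g_  : GTerm → GTerm → GAtom

  data Literal : Set where
    pos : Atom → Literal
    neg : Atom → Literal

  Conjunction : Set
  Conjunction = List Literal

  Disjunction : Set
  Disjunction = List⁺ Conjunction

  GSubst : Set
  GSubst = Var → GTerm

  mutual
    substT : GSubst → Term → GTerm
    substT σ (var x)   = σ x
    substT σ (fn f ts) = gfn f (substTs σ ts)

    substTs : ∀ {n} → GSubst → Vec Term n → Vec GTerm n
    substTs σ []       = []
    substTs σ (t ∷ ts) = substT σ t ∷ substTs σ ts

  substA : GSubst → Atom → GAtom
  substA σ (atom p ts) = gatom p (substTs σ ts)
  substA σ (s ≐ t)     = substT σ s ≐g substT σ t

  -- A predicate definition (H, ∃W[D]) with H = p(V1,...,Vn), the Vi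
  -- distinct variables.  W = vars(D) \ vars(H) is determined by H and D.
  record Definition : Set where
    field
      hpred    : PSym
      hvars    : Vec Var (parity hpred)
      distinct : Unique (toList hvars)
      body     : Disjunction

  record Program : Set where
    field
      defs     : List Definition
      distinctHeads : AllPairs (λ d e → Definition.hpred d ≢ Definition.hpred e) defs

  record Interp : Set₁ where
    field
      T : GAtom → Set
      F : GAtom → Set
      eq-same : ∀ s s' → s ≡ s' → T (s ≐g s') × ¬ F (s ≐g s')
      eq-diff : ∀ s s' → s ≢ s' → F (s ≐g s') × ¬ T (s ≐g s')

  _⊓_ : Interp → Interp → Interp
  M ⊓ N = record
    { T = λ A → Interp.T M A × Interp.T N A
    ; F = λ A → Interp.F M A × Interp.F N A
    ; eq-same = λ s s' e →
        (Data.Product.proj₁ (Interp.eq-same M s s' e) Data.Product., Data.Product.proj₁ (Interp.eq-same N s s' e))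
        Data.Product., (λ p → Data.Product.proj₂ (Interp.eq-same M s s' e) (Data.Product.proj₁ p))
    ; eq-diff = λ s s' e →
        (Data.Product.proj₁ (Interp.eq-diff M s s' e) Data.Product., Data.Product.proj₁ (Interp.eq-diff N s s' e))
        Data.Product., (λ p → Data.Product.proj₂ (Interp.eq-diff M s s' e) (Data.Product.proj₁ p))
    }

  module _ (I : Interp) (σ : GSubst) where
    open Interp I

    TrueA FalseA : Atom → Set
    TrueA  A = T (substA σ A)
    FalseA A = F (substA σ A)

    TrueL FalseL : Literal → Set
    TrueL (pos A)  = TrueA A
    TrueL (neg A)  = FalseA A
    FalseL (pos A) = FalseA A
    FalseL (neg A) = TrueA A

    TrueC FalseC : Conjunction → Set
    TrueC C  = All TrueL C
    FalseC C = Any FalseL C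

    TrueD FalseD : Disjunction → Set
    TrueD D  = Any TrueC (toList⁺ D)
    FalseD D = All FalseC (toList⁺ D)

  AgreeOn : List Var → GSubst → GSubst → Set
  AgreeOn vs θ σ = All (λ v → σ v ≡ θ v) vs

  -- Ground head H θ; the body is ∃W[D θ], whose
  -- ground instances are D σ for σ agreeing with θ on vars(H)
  -- (W = vars(D) \ vars(H) are exactly the remaining variables).
  headAtom : (d : Definition) → GSubst → GAtom
  headAtom d θ = gatom (Definition.hpred d) (Data.Vec.map θ (Definition.hvars d))

  -- Four-valued truth values represented by the pair
  -- (is-true, is-false) of propositions: u = (no,no), t = (yes,no),
  -- f = (no,yes), i = (yes,yes).
  record Val : Set₁ where
    constructor ⟨_,_⟩
    field
      isT : Set
      isF : Set

  _⊑_ : Val → Val → Set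
  x ⊑ y = (Val.isT x → Val.isT y) × (Val.isF x → Val.isF y)

  valHead : Interp → GAtom → Val
  valHead I A = ⟨ Interp.T I A , Interp.F I A ⟩

  valBody : Interp → Definition → GSubst → Val
  valBody I d θ =
    ⟨ ∃ (λ σ → AgreeOn (toList (Definition.hvars d)) θ σ × TrueD I σ (Definition.body d))
    , (∀ σ → AgreeOn (toList (Definition.hvars d)) θ σ → FalseD I σ (Definition.body d)) ⟩

  IsModel4 : Program → Interp → Set
  IsModel4 P I = ∀ d → d ∈ Program.defs P → ∀ (θ : GSubst) →
    valBody I d θ ⊑ valHead I (headAtom d θ)

-- Truth and falsity of bodies are monotone in the knowledge order (T and F
-- both grow), and M ⊓ N lies below M and N.  So the body value under M ⊓ N is
-- below the head values under M and under N, hence below their meet, which is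
-- the head value under M ⊓ N.
module Submission where

open import Defs
open import Data.Product using (_×_; _,_; proj₁; proj₂)
open import Function using (_∘_)
open import Data.List.Relation.Unary.All as All using ()
open import Data.List.Relation.Unary.Any as Any using ()

module Knowledge (S : Signature) where
  open Lang S

  infix 4 _≤ᵏ_

  _≤ᵏ_ : Interp → Interp → Set
  I ≤ᵏ J = (∀ A → Interp.T I A → Interp.T J A) × (∀ A → Interp.F I A → Interp.F J A)

  ⊓-≤ᵏˡ : ∀ M N → M ⊓ N ≤ᵏ M
  ⊓-≤ᵏˡ M N = (λ _ → proj₁) , (λ _ → proj₁)

  ⊓-≤ᵏʳ : ∀ M N → M ⊓ N ≤ᵏ N
  ⊓-≤ᵏʳ M N = (λ _ → proj₂) , (λ _ → proj₂)

  ⊑-trans : ∀ {x y z} → x ⊑ y → y ⊑ z → x ⊑ z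
  ⊑-trans (xyT , xyF) (yzT , yzF) = yzT ∘ xyT , yzF ∘ xyF

  ⊑-valHead-⊓ : ∀ {x} M N A → x ⊑ valHead M A → x ⊑ valHead N A → x ⊑ valHead (M ⊓ N) A
  ⊑-valHead-⊓ M N A (xMT , xMF) (xNT , xNF) =
    (λ t → xMT t , xNT t) , (λ f → xMF f , xNF f)

  module _ {I J : Interp} (I≤J : I ≤ᵏ J) (σ : GSubst) where
    private
      T-mono : ∀ A → Interp.T I A → Interp.T J A
      T-mono = proj₁ I≤J

      F-mono : ∀ A → Interp.F I A → Interp.F J A
      F-mono = proj₂ I≤J

    TrueL-mono : ∀ l → TrueL I σ l → TrueL J σ l
    TrueL-mono (pos A) = T-mono _
    TrueL-mono (neg A) = F-mono _

    FalseL-mono : ∀ l → FalseL I σ l → FalseL J σ l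
    FalseL-mono (pos A) = F-mono _
    FalseL-mono (neg A) = T-mono _

    TrueD-mono : ∀ D → TrueD I σ D → TrueD J σ D
    TrueD-mono D = Any.map (All.map λ {l} → TrueL-mono l)

    FalseD-mono : ∀ D → FalseD I σ D → FalseD J σ D
    FalseD-mono D = All.map (Any.map λ {l} → FalseL-mono l)

  valBody-mono : ∀ {I J} → I ≤ᵏ J → ∀ d θ → valBody I d θ ⊑ valBody J d θ
  valBody-mono I≤J d θ =
    (λ (σ , agree , true) → σ , agree , TrueD-mono I≤J σ B true)
    , (λ false σ agree → FalseD-mono I≤J σ B (false σ agree))
    where B = Definition.body d

proposition7p1 : (S : Signature) → let open Lang S in
    (P : Program) (M N : Interp) →
    IsModel4 P M → IsModel4 P N → IsModel4 P (M ⊓ N)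
proposition7p1 S P M N M-model N-model d d∈P θ =
  ⊑-valHead-⊓ M N (headAtom d θ)
    (⊑-trans (valBody-mono (⊓-≤ᵏˡ M N) d θ) (M-model d d∈P θ))
    (⊑-trans (valBody-mono (⊓-≤ᵏʳ M N) d θ) (N-model d d∈P θ))
  where
    open Lang S
    open Knowledge S
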